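{- Let $G$ be a connected split graph and let $C\uplus I$ be a split partition of $G$. If $G$ is a unit interval graph, then $|I|\le 3$, and $|I| = 3$ holds only when there is a vertex $v\in I$ adjacent to all vertices of $C$.
   Context: All graphs are finite, simple and undirected. A graph is a split graph if its vertex set can be partitioned into a clique $C$ and an independent set $I$ (a split partition $C\uplus I$). A graph is a unit interval graph if its vertices can be assigned intervals of the real line, all of the same length, so that two vertices are adjacent iff their intervals intersect.
   Formalization: The intervals assigned to the vertices in the unit interval hypothesis have rational endpoints rather than arbitrary real endpoints. -}

module Defs where

open import Data.Nat using (ℕ; suc)
open import Data.Fin using (Fin)
open import Data.Fin.Subset using (Subset; _∈_; _∉_)
open import Data.Product using (∃)
open import Relation.Binary.PropositionalEquality using (_≡_)
open import Relation.Nullary using (¬_)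
import Data.Rational as ℚ
open ℚ using (ℚ; 1ℚ)

record Graph (n : ℕ) : Set₁ where
  field
    Adj     : Fin n → Fin n → Set
    sym     : ∀ {u v} → Adj u v → Adj v u
    irrefl  : ∀ {u} → ¬ Adj u u
open Graph public

data Walk {n : ℕ} (G : Graph n) : Fin n → Fin n → Set where
  here : ∀ {u} → Walk G u u
  step : ∀ {u w v} → Adj G u w → Walk G w v → Walk G u v

Connected : ∀ {n} → Graph n → Set
Connected G = ∀ u v → Walk G u v

IsClique : ∀ {n} → Graph n → Subset n → Set
IsClique G S = ∀ u v → u ∈ S → v ∈ S → ¬ u ≡ v → Adj G u v

IsIndependent : ∀ {n} → Graph n → Subset n → Set
IsIndependent G S = ∀ u v → u ∈ S → v ∈ S → ¬ Adj G u v

IsSplitPartition : ∀ {n} → Graph n → Subset n → Subset n → Set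
IsSplitPartition {n} G C I =
  (∀ v → v ∈ C → v ∉ I) × (∀ v → v ∉ C → v ∈ I) × IsClique G C × IsIndependent G I
  where open import Data.Product using (_×_)

-- Unit interval graph: vertex v gets the closed interval [a v , a v + 1];
-- distinct u, v adjacent iff the intervals intersect, i.e. |a u - a v| ≤ 1.
IsUnitInterval : ∀ {n} → Graph n → Set
IsUnitInterval {n} G =
  ∃ λ (a : Fin n → ℚ) → ∀ u v → ¬ u ≡ v →
    (Adj G u v → ℚ.∣ a u ℚ.- a v ∣ ℚ.≤ 1ℚ) × (ℚ.∣ a u ℚ.- a v ∣ ℚ.≤ 1ℚ → Adj G u v)
  where open import Data.Product using (_×_)

{-# OPTIONS --safe #-}
module Submission where

-- Distinct vertices of the independent set I have positions more than 1 apart, so any two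
-- are comparable under x ≺ y :⇔ a x + 1 < a y; by connectedness every vertex of I has a
-- neighbour in the clique C, whose positions all lie within 1 of each other. If x ≺ y ≺ z in
-- I, the C-neighbours of x and z squeeze every vertex of C to within 1 of y, so y is adjacent
-- to all of C; a fourth vertex w with z ≺ w would then have its C-neighbour more than 1 to the
-- right of y. Every semicomplete digraph has a Hamiltonian path, so three vertices of I always
-- form a chain x ≺ y ≺ z, and four would form a chain x ≺ y ≺ z ≺ w.

open import Defs
open import Data.Nat using (ℕ; zero; suc; _≤_; s≤s)
open import Data.Nat.Properties using (≮⇒≥; ≤-reflexive)
open import Data.Fin using (Fin; zero; suc; #_; _≟_)
open import Data.Fin.Properties using (suc-injective)
open import Data.Fin.Subset using (Subset; _∈_; _∉_; ∣_∣; inside; outside)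
open import Data.Fin.Subset.Properties using (_∈?_)
open import Data.Vec using (_∷_; here; there)
open import Data.Product using (Σ; ∃; ∃-syntax; _×_; _,_; proj₁; proj₂)
open import Data.Sum using (_⊎_; inj₁; inj₂)
open import Data.Empty using (⊥; ⊥-elim)
open import Function using (_∘_)
open import Function.Definitions using (Injective)
open import Level using (Level; _⊔_)
open import Relation.Binary.Core using (Rel)
open import Relation.Binary.PropositionalEquality as ≡
  using (_≡_; _≢_; refl; cong; subst; subst₂)
open import Relation.Nullary using (¬_; yes; no)
open import Relation.Unary using (Pred)
open import Data.Rational as ℚ using (ℚ; 0ℚ; 1ℚ; _+_; _-_; -_)
import Data.Rational.Properties as ℚ
open import Algebra.Properties.Group ℚ.+-0-group using (//-rightDividesˡ; //-rightDividesʳ)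
open import Algebra.Properties.AbelianGroup ℚ.+-0-abelianGroup using (⁻¹-anti-homo‿-)

private
  variable
    ℓ ℓ′ ℓ″ : Level
    A : Set ℓ

p<p+1 : ∀ p → p ℚ.< p + 1ℚ
p<p+1 p = subst (ℚ._< p + 1ℚ) (ℚ.+-identityʳ p) (ℚ.+-monoʳ-< p (ℚ.positive⁻¹ 1ℚ))

+-cancelʳ-< : ∀ {p q} r → p + r ℚ.< q + r → p ℚ.< q
+-cancelʳ-< {p} {q} r h =
  subst₂ ℚ._<_ (//-rightDividesʳ r p) (//-rightDividesʳ r q) (ℚ.+-monoˡ-< (- r) h)

p≤∣p∣ : ∀ p → p ℚ.≤ ℚ.∣ p ∣
p≤∣p∣ p with ℚ.≤-total 0ℚ p
... | inj₁ 0≤p = ℚ.≤-reflexive (≡.sym (ℚ.0≤p⇒∣p∣≡p 0≤p))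
... | inj₂ p≤0 = ℚ.≤-trans p≤0 (ℚ.0≤∣p∣ p)

p-q≤r⇒p≤q+r : ∀ {p q r} → p - q ℚ.≤ r → p ℚ.≤ q + r
p-q≤r⇒p≤q+r {p} {q} {r} h =
  subst₂ ℚ._≤_ (//-rightDividesˡ q p) (ℚ.+-comm r q) (ℚ.+-monoˡ-≤ q h)

p≤q+r⇒p-q≤r : ∀ {p q r} → p ℚ.≤ q + r → p - q ℚ.≤ r
p≤q+r⇒p-q≤r {p} {q} {r} h =
  subst (p - q ℚ.≤_) (≡.trans (cong (_- q) (ℚ.+-comm q r)) (//-rightDividesʳ q r))
    (ℚ.+-monoˡ-≤ (- q) h)

∣p-q∣≤r⇒p≤q+r : ∀ {p q r} → ℚ.∣ p - q ∣ ℚ.≤ r → p ℚ.≤ q + r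
∣p-q∣≤r⇒p≤q+r {p} {q} h = p-q≤r⇒p≤q+r (ℚ.≤-trans (p≤∣p∣ (p - q)) h)

p≤q+r⇒q≤p+r⇒∣p-q∣≤r : ∀ {p q r} → p ℚ.≤ q + r → q ℚ.≤ p + r → ℚ.∣ p - q ∣ ℚ.≤ r
p≤q+r⇒q≤p+r⇒∣p-q∣≤r {p} {q} {r} p≤q+r q≤p+r
  with ℚ.∣p∣≡p∨∣p∣≡-p (p - q)
... | inj₁ ∣p-q∣≡p-q  = subst (ℚ._≤ r) (≡.sym ∣p-q∣≡p-q) (p≤q+r⇒p-q≤r p≤q+r)
... | inj₂ ∣p-q∣≡-p-q =
  subst (ℚ._≤ r) (≡.sym (≡.trans ∣p-q∣≡-p-q (⁻¹-anti-homo‿- p q))) (p≤q+r⇒p-q≤r q≤p+r)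

∣p-q∣≰r⇒p+r<q⊎q+r<p : ∀ {p q r} → ¬ ℚ.∣ p - q ∣ ℚ.≤ r → p + r ℚ.< q ⊎ q + r ℚ.< p
∣p-q∣≰r⇒p+r<q⊎q+r<p {p} {q} {r} far with p ℚ.≤? q + r | q ℚ.≤? p + r
... | no p≰q+r | _          = inj₂ (ℚ.≰⇒> p≰q+r)
... | yes _    | no q≰p+r   = inj₁ (ℚ.≰⇒> q≰p+r)
... | yes p≤q+r | yes q≤p+r = ⊥-elim (far (p≤q+r⇒q≤p+r⇒∣p-q∣≤r p≤q+r q≤p+r))

DistinctElements : ∀ {n} → ℕ → Subset n → Set
DistinctElements {n} k s = Σ (Fin k → Fin n) λ f → Injective _≡_ _≡_ f × (∀ i → f i ∈ s)

distinctElements : ∀ {n k} (s : Subset n) → k ≤ ∣ s ∣ → DistinctElements k s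
distinctElements {k = zero} s _ = (λ ()) , (λ { {()} }) , λ ()
distinctElements {suc n} {suc k} (inside ∷ s) (s≤s k≤∣s∣) = f , f-injective , f∈s
  where
  rest : DistinctElements k s
  rest = distinctElements s k≤∣s∣

  f : Fin (suc k) → Fin (suc n)
  f zero    = zero
  f (suc i) = suc (proj₁ rest i)

  f-injective : Injective _≡_ _≡_ f
  f-injective {zero}  {zero}  _  = refl
  f-injective {suc i} {suc j} eq = cong suc (proj₁ (proj₂ rest) (suc-injective eq))

  f∈s : ∀ i → f i ∈ inside ∷ s
  f∈s zero    = here
  f∈s (suc i) = there (proj₂ (proj₂ rest) i)
distinctElements {k = suc k} (outside ∷ s) k≤∣s∣ =
  let f , f-injective , f∈s = distinctElements s k≤∣s∣
  in  suc ∘ f , f-injective ∘ suc-injective , there ∘ f∈s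

Semicomplete : ∀ {k} → Rel A ℓ″ → (Fin k → A) → Set ℓ″
Semicomplete R f = ∀ i j → i ≢ j → R (f i) (f j) ⊎ R (f j) (f i)

Path₃ : {A : Set ℓ} → Pred A ℓ′ → Rel A ℓ″ → Set (ℓ ⊔ ℓ′ ⊔ ℓ″)
Path₃ P R = ∃[ x ] ∃[ y ] ∃[ z ] (P x × P y × P z) × R x y × R y z

Path₄ : {A : Set ℓ} → Pred A ℓ′ → Rel A ℓ″ → Set (ℓ ⊔ ℓ′ ⊔ ℓ″)
Path₄ P R = ∃[ x ] ∃[ y ] ∃[ z ] ∃[ w ] (P x × P y × P z × P w) × R x y × R y z × R z w

hamiltonianPath₃ : (P : Pred A ℓ′) (R : Rel A ℓ″) (f : Fin 3 → A) →
  (∀ i → P (f i)) → Semicomplete R f → Path₃ P R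
hamiltonianPath₃ {A = A} P R f Pf Rf =
  path (Rf (# 0) (# 1) λ ()) (Rf (# 1) (# 2) λ ()) (Rf (# 0) (# 2) λ ())
  where
  u v w : A
  u = f (# 0)
  v = f (# 1)
  w = f (# 2)

  Pu : P u
  Pu = Pf (# 0)
  Pv : P v
  Pv = Pf (# 1)
  Pw : P w
  Pw = Pf (# 2)

  path : R u v ⊎ R v u → R v w ⊎ R w v → R u w ⊎ R w u → Path₃ P R
  path (inj₁ uv) (inj₁ vw) _         = u , v , w , (Pu , Pv , Pw) , uv , vw
  path (inj₁ uv) (inj₂ wv) (inj₁ uw) = u , w , v , (Pu , Pw , Pv) , uw , wv
  path (inj₁ uv) (inj₂ wv) (inj₂ wu) = w , u , v , (Pw , Pu , Pv) , wu , uv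
  path (inj₂ vu) (inj₁ vw) (inj₁ uw) = v , u , w , (Pv , Pu , Pw) , vu , uw
  path (inj₂ vu) (inj₁ vw) (inj₂ wu) = v , w , u , (Pv , Pw , Pu) , vw , wu
  path (inj₂ vu) (inj₂ wv) _         = w , v , u , (Pw , Pv , Pu) , wv , vu

hamiltonianPath₄ : (P : Pred A ℓ′) (R : Rel A ℓ″) (f : Fin 4 → A) →
  (∀ i → P (f i)) → Semicomplete R f → Path₄ P R
hamiltonianPath₄ {A = A} {ℓ′ = ℓ′} {ℓ″ = ℓ″} P R f Pf Rf =
  insert (hamiltonianPath₃ P⁺ R (f ∘ suc) P⁺f
            λ i j i≢j → Rf (suc i) (suc j) (i≢j ∘ suc-injective))
  where
  t : A
  t = f zero

  Pt : P t
  Pt = Pf zero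

  -- Along a path through the other three points, P⁺ remembers how each of them compares with t.
  P⁺ : Pred A (ℓ′ ⊔ ℓ″)
  P⁺ x = P x × (R x t ⊎ R t x)

  P⁺f : ∀ i → P⁺ (f (suc i))
  P⁺f i = Pf (suc i) , Rf (suc i) zero λ ()

  insert : Path₃ P⁺ R → Path₄ P R
  insert (x , y , z , ((Px , _) , (Py , inj₁ yt) , (Pz , inj₁ zt)) , xy , yz) =
    x , y , z , t , (Px , Py , Pz , Pt) , xy , yz , zt
  insert (x , y , z , ((Px , _) , (Py , inj₁ yt) , (Pz , inj₂ tz)) , xy , yz) =
    x , y , t , z , (Px , Py , Pt , Pz) , xy , yt , tz
  insert (x , y , z , ((Px , inj₁ xt) , (Py , inj₂ ty) , (Pz , _)) , xy , yz) =
    x , t , y , z , (Px , Pt , Py , Pz) , xt , ty , yz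
  insert (x , y , z , ((Px , inj₂ tx) , (Py , inj₂ ty) , (Pz , _)) , xy , yz) =
    t , x , y , z , (Pt , Px , Py , Pz) , tx , xy , yz

adj⇒≢ : ∀ {n} (G : Graph n) {u v} → Adj G u v → u ≢ v
adj⇒≢ G uv refl = irrefl G uv

module SplitUnitInterval {n} (G : Graph n) (C I : Subset n) (connected : Connected G)
                         (split : IsSplitPartition G C I) (unit : IsUnitInterval G) where

  a : Fin n → ℚ
  a = proj₁ unit

  C⇒∉I : ∀ {v} → v ∈ C → v ∉ I
  C⇒∉I = proj₁ split _

  ∉C⇒∈I : ∀ {v} → v ∉ C → v ∈ I
  ∉C⇒∈I = proj₁ (proj₂ split) _

  C-clique : IsClique G C
  C-clique = proj₁ (proj₂ (proj₂ split))

  I-independent : IsIndependent G I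
  I-independent = proj₂ (proj₂ (proj₂ split))

  adj⇒close : ∀ {u v} → Adj G u v → ℚ.∣ a u - a v ∣ ℚ.≤ 1ℚ
  adj⇒close {u} {v} uv = proj₁ (proj₂ unit u v (adj⇒≢ G uv)) uv

  close⇒adj : ∀ {u v} → u ≢ v → ℚ.∣ a u - a v ∣ ℚ.≤ 1ℚ → Adj G u v
  close⇒adj {u} {v} u≢v = proj₂ (proj₂ unit u v u≢v)

  adj⇒≤+1 : ∀ {u v} → Adj G u v → a u ℚ.≤ a v + 1ℚ
  adj⇒≤+1 = ∣p-q∣≤r⇒p≤q+r ∘ adj⇒close

  ≤+1⇒adj : ∀ {u v} → u ≢ v → a u ℚ.≤ a v + 1ℚ → a v ℚ.≤ a u + 1ℚ → Adj G u v
  ≤+1⇒adj u≢v u≤v+1 v≤u+1 = close⇒adj u≢v (p≤q+r⇒q≤p+r⇒∣p-q∣≤r u≤v+1 v≤u+1)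

  C⇒≤+1 : ∀ {u v} → u ∈ C → v ∈ C → a u ℚ.≤ a v + 1ℚ
  C⇒≤+1 {u} {v} u∈C v∈C with u ≟ v
  ... | yes refl = ℚ.<⇒≤ (p<p+1 (a u))
  ... | no u≢v   = adj⇒≤+1 (C-clique u v u∈C v∈C u≢v)

  neighbourInC : ∀ {u v} → u ∈ I → u ≢ v → ∃[ c ] c ∈ C × Adj G u c
  neighbourInC {u} {v} u∈I u≢v with connected u v
  ... | here = ⊥-elim (u≢v refl)
  ... | step {w = w} uw _ with w ∈? C
  ...   | yes w∈C = w , w∈C , uw
  ...   | no w∉C  = ⊥-elim (I-independent u w u∈I (∉C⇒∈I w∉C) uw)

  _≺_ : Fin n → Fin n → Set
  x ≺ y = a x + 1ℚ ℚ.< a y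

  ≺⇒≢ : ∀ {x y} → x ≺ y → x ≢ y
  ≺⇒≢ {x} x≺x refl = ℚ.<-asym x≺x (p<p+1 (a x))

  ≺-semicomplete : ∀ {k} (f : Fin k → Fin n) → Injective _≡_ _≡_ f → (∀ i → f i ∈ I) →
                   Semicomplete _≺_ f
  ≺-semicomplete f f-injective f∈I i j i≢j =
    ∣p-q∣≰r⇒p+r<q⊎q+r<p λ close →
      I-independent (f i) (f j) (f∈I i) (f∈I j) (close⇒adj (i≢j ∘ f-injective) close)

  ≺-adjʳ : ∀ {x y c} → x ≺ y → Adj G y c → a x ℚ.< a c
  ≺-adjʳ x≺y yc = +-cancelʳ-< 1ℚ (ℚ.<-≤-trans x≺y (adj⇒≤+1 yc))

  ≺-adjˡ : ∀ {c x y} → Adj G c x → x ≺ y → a c ℚ.< a y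
  ≺-adjˡ cx x≺y = ℚ.≤-<-trans (adj⇒≤+1 cx) x≺y

  CompleteToC : Fin n → Set
  CompleteToC v = ∀ u → u ∈ C → Adj G v u

  between⇒completeToC : ∀ {x y z} → x ∈ I → y ∈ I → z ∈ I → x ≺ y → y ≺ z → CompleteToC y
  between⇒completeToC {y = y} x∈I y∈I z∈I x≺y y≺z u u∈C =
    let cˣ , cˣ∈C , xcˣ = neighbourInC x∈I (≺⇒≢ x≺y)
        cᶻ , cᶻ∈C , zcᶻ = neighbourInC z∈I (≺⇒≢ y≺z ∘ ≡.sym)
        y≤u+1 : a y ℚ.≤ a u + 1ℚ
        y≤u+1 = ℚ.<⇒≤ (ℚ.<-≤-trans (≺-adjʳ y≺z zcᶻ) (C⇒≤+1 cᶻ∈C u∈C))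
        u≤y+1 : a u ℚ.≤ a y + 1ℚ
        u≤y+1 = ℚ.≤-trans (C⇒≤+1 u∈C cˣ∈C) (ℚ.<⇒≤ (ℚ.+-monoˡ-< 1ℚ (≺-adjˡ (sym G xcˣ) x≺y)))
    in  ≤+1⇒adj (λ y≡u → C⇒∉I u∈C (subst (_∈ I) y≡u y∈I)) y≤u+1 u≤y+1

  completeToC⇒¬≺≺ : ∀ {y z w} → CompleteToC y → w ∈ I → y ≺ z → z ≺ w → ⊥
  completeToC⇒¬≺≺ y-complete w∈I y≺z z≺w =
    let cʷ , cʷ∈C , wcʷ = neighbourInC w∈I (≺⇒≢ z≺w ∘ ≡.sym)
    in  ℚ.<-irrefl refl
          (ℚ.<-≤-trans (ℚ.<-trans y≺z (≺-adjʳ z≺w wcʷ)) (adj⇒≤+1 (sym G (y-complete cʷ cʷ∈C))))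

  ¬fourIndependent : ¬ DistinctElements 4 I
  ¬fourIndependent (f , f-injective , f∈I) =
    let x , y , z , w , (x∈I , y∈I , z∈I , w∈I) , x≺y , y≺z , z≺w =
          hamiltonianPath₄ (_∈ I) _≺_ f f∈I (≺-semicomplete f f-injective f∈I)
    in  completeToC⇒¬≺≺ (between⇒completeToC x∈I y∈I z∈I x≺y y≺z) w∈I y≺z z≺w

  threeIndependent⇒completeToC : DistinctElements 3 I → ∃[ v ] v ∈ I × CompleteToC v
  threeIndependent⇒completeToC (f , f-injective , f∈I) =
    let x , y , z , (x∈I , y∈I , z∈I) , x≺y , y≺z =
          hamiltonianPath₃ (_∈ I) _≺_ f f∈I (≺-semicomplete f f-injective f∈I)
    in  y , y∈I , between⇒completeToC x∈I y∈I z∈I x≺y y≺z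

proposition4 : ∀ {n} (G : Graph n) (C I : Subset n) →
    Connected G → IsSplitPartition G C I → IsUnitInterval G →
    (∣ I ∣ ≤ 3) × (∣ I ∣ ≡ 3 → ∃ λ v → v ∈ I × (∀ u → u ∈ C → Adj G v u))
proposition4 G C I connected split unit =
    ≮⇒≥ (λ 3<∣I∣ → ¬fourIndependent (distinctElements I 3<∣I∣))
  , λ ∣I∣≡3 → threeIndependent⇒completeToC (distinctElements I (≤-reflexive (≡.sym ∣I∣≡3)))
  where open SplitUnitInterval G C I connected split unit
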